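{- Let $Q=(q_k)_{k\ge1}$ be a sequence of integers with $q_k>1$, let $\varepsilon_k\in\{0,1,\dots,q_k-1\}$ for all $k$, and let $x=\sum_{k=1}^\infty\frac{\varepsilon_k}{q_1q_2\cdots q_k}$. For $n\ge0$ put $\sigma^n(x)=\sum_{k=n+1}^\infty\frac{\varepsilon_k}{q_{n+1}\cdots q_k}$. Let $n_0$ be a fixed positive integer. Then $\sigma^n(x)$ takes the same value for all $n\ge n_0$ if and only if $\frac{\varepsilon_n}{q_n-1}$ takes the same value for all $n>n_0$. -}

module Defs where

open import Data.Nat using (ℕ; zero; suc; _+_)
open import Data.Integer using (+_)
open import Data.Rational using (ℚ; 0ℚ; 1ℚ; _/_; _*_; _-_; ∣_∣; _≤_)
import Data.Rational as ℚ
open import Data.Product using (∃)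
open import Data.Nat using () renaming (_≤_ to _≤ℕ_)

-- Total version of the rational a / b (b ≠ 0); the value at b = 0 is
-- irrelevant (never used under the hypotheses of the statement).
frac : ℕ → ℕ → ℚ
frac a zero    = 0ℚ
frac a (suc b) = (+ a) / suc b

inv : ℕ → ℚ
inv b = frac 1 b

P : (ℕ → ℕ) → ℕ → ℕ → ℚ
P q n zero    = 1ℚ
P q n (suc i) = P q n i * inv (q (n + suc i))

-- S q ε n m = Σ_{i=1}^{m} ε_{n+i} / (q_{n+1} ... q_{n+i}),
-- the m-th partial sum of the series defining σ^n(x).
S : (ℕ → ℕ) → (ℕ → ℕ) → ℕ → ℕ → ℚ
S q ε n zero    = 0ℚ
S q ε n (suc i) = S q ε n i ℚ.+ (frac (ε (n + suc i)) 1 * P q n (suc i))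

-- Two (convergent) rational sequences have the same real limit:
-- their difference tends to 0.
SameLimit : (ℕ → ℚ) → (ℕ → ℚ) → Set
SameLimit a b = ∀ (e : ℚ) → 0ℚ ℚ.< e → ∃ λ M → ∀ m → M ≤ℕ m → ∣ a m - b m ∣ ≤ e

{-# OPTIONS --safe #-}
-- Put r_k = 1/q_k and c_k = ε_k/(q_k − 1). Then ε_k r_k = c_k (1 − r_k): c_k is the fixed point of
-- the map y ↦ r_k (ε_k + y), which sends σ^k(x) to σ^(k−1)(x).
-- If c_k = C for all k > n, the partial sums satisfy S_n(i) + C P_n(i) = C, and P_n(i) ≤ 1/(i+1),
-- so σ^n(x) = C for every n ≥ n₀.
-- Conversely, if σ^(k−1)(x) = σ^k(x), this common value is the fixed point c_k: on partial sums,
-- S_k(i) − S_(k−1)(i+1) = (1 − r_k)(S_k(i) − c_k) with 1 − r_k ≥ ½, while the last term of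
-- S_(k−1)(i+1) is at most P_(k−1)(i) → 0. Uniqueness of limits then gives c_n = c_m for n, m > n₀.
module Submission where

open import Defs
open import Data.Empty using (⊥-elim)
open import Data.Integer as ℤ using (+_)
import Data.Integer.Properties as ℤ
open import Data.Nat as ℕ using (ℕ; zero; suc; _∸_; z≤n; s≤s)
import Data.Nat.Properties as ℕ
open import Data.Product using (∃; _,_; _×_; proj₁; proj₂)
open import Data.Rational as ℚ
  using (ℚ; mkℚ; 0ℚ; 1ℚ; ½; _+_; _-_; _*_; -_; ∣_∣; _≤_; _<_; toℚᵘ; positive)
open import Data.Rational.Properties as ℚ using (+-*-commutativeRing; +-0-group; _≟_)
import Data.Rational.Unnormalised as ℚᵘ
import Data.Rational.Unnormalised.Properties as ℚᵘ
open import Function.Bundles using (_⇔_; mk⇔)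
open import Level using (0ℓ)
open import Relation.Binary.PropositionalEquality
open import Relation.Nullary.Decidable using (dec⇒maybe; yes; no)
import Algebra.Properties.Group as GroupProperties
open import Tactic.RingSolver using (solve-∀)
import Tactic.RingSolver.Core.AlmostCommutativeRing as ACR

ℚ-ring : ACR.AlmostCommutativeRing 0ℓ 0ℓ
ℚ-ring = ACR.fromCommutativeRing +-*-commutativeRing (λ x → dec⇒maybe (0ℚ ≟ x))

fromℕ : ℕ → ℚ
fromℕ n = frac n 1

toℚᵘ-frac : ∀ a b → toℚᵘ (frac a (suc b)) ℚᵘ.≃ ℚᵘ.mkℚᵘ (+ a) b
toℚᵘ-frac a b = ℚ.toℚᵘ-fromℚᵘ (ℚᵘ.mkℚᵘ (+ a) b)

frac-≡ : ∀ a b c d → a ℕ.* suc d ≡ c ℕ.* suc b → frac a (suc b) ≡ frac c (suc d)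
frac-≡ a b c d eq = ℚ.fromℚᵘ-cong {ℚᵘ.mkℚᵘ (+ a) b} {ℚᵘ.mkℚᵘ (+ c) d} (ℚᵘ.*≡* (begin
  + a ℤ.* + suc d  ≡⟨ ℤ.pos-* a (suc d) ⟨
  + (a ℕ.* suc d)  ≡⟨ cong +_ eq ⟩
  + (c ℕ.* suc b)  ≡⟨ ℤ.pos-* c (suc b) ⟩
  + c ℤ.* + suc b  ∎))
  where open ≡-Reasoning

frac-≤ : ∀ a b c d → a ℕ.* suc d ℕ.≤ c ℕ.* suc b → frac a (suc b) ≤ frac c (suc d)
frac-≤ a b c d le = ℚ.toℚᵘ-cancel-≤
  (ℚᵘ.≤-respʳ-≃ (ℚᵘ.≃-sym (toℚᵘ-frac c d)) (ℚᵘ.≤-respˡ-≃ (ℚᵘ.≃-sym (toℚᵘ-frac a b))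
    (ℚᵘ.*≤* (subst₂ ℤ._≤_ (ℤ.pos-* a (suc d)) (ℤ.pos-* c (suc b)) (ℤ.+≤+ le)))))

frac-* : ∀ a b c d → frac a (suc b) * frac c (suc d) ≡ frac (a ℕ.* c) (suc b ℕ.* suc d)
frac-* a b c d = ℚ.toℚᵘ-injective (begin
  toℚᵘ (frac a (suc b) * frac c (suc d))             ≈⟨ ℚ.toℚᵘ-homo-* (frac a (suc b)) (frac c (suc d)) ⟩
  toℚᵘ (frac a (suc b)) ℚᵘ.* toℚᵘ (frac c (suc d))   ≈⟨ ℚᵘ.*-cong (toℚᵘ-frac a b) (toℚᵘ-frac c d) ⟩
  ℚᵘ.mkℚᵘ (+ a ℤ.* + c) _                            ≡⟨ cong (λ z → ℚᵘ.mkℚᵘ z _) (ℤ.pos-* a c) ⟨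
  ℚᵘ.mkℚᵘ (+ (a ℕ.* c)) _                            ≈⟨ toℚᵘ-frac (a ℕ.* c) _ ⟨
  toℚᵘ (frac (a ℕ.* c) (suc b ℕ.* suc d))            ∎)
  where open ℚᵘ.≃-Reasoning

fromℕ-+ : ∀ m n → fromℕ (m ℕ.+ n) ≡ fromℕ m + fromℕ n
fromℕ-+ m n = ℚ.toℚᵘ-injective (begin
  toℚᵘ (fromℕ (m ℕ.+ n))              ≈⟨ toℚᵘ-frac (m ℕ.+ n) 0 ⟩
  ℚᵘ.mkℚᵘ (+ (m ℕ.+ n)) 0             ≡⟨ cong (λ z → ℚᵘ.mkℚᵘ z 0) pos-+-unit ⟩
  ℚᵘ.mkℚᵘ (+ m) 0 ℚᵘ.+ ℚᵘ.mkℚᵘ (+ n) 0 ≈⟨ ℚᵘ.+-cong (toℚᵘ-frac m 0) (toℚᵘ-frac n 0) ⟨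
  toℚᵘ (fromℕ m) ℚᵘ.+ toℚᵘ (fromℕ n)   ≈⟨ ℚ.toℚᵘ-homo-+ (fromℕ m) (fromℕ n) ⟨
  toℚᵘ (fromℕ m + fromℕ n)            ∎)
  where
  open ℚᵘ.≃-Reasoning
  pos-+-unit : + (m ℕ.+ n) ≡ + m ℤ.* + 1 ℤ.+ + n ℤ.* + 1
  pos-+-unit = trans (ℤ.pos-+ m n) (sym (cong₂ ℤ._+_ (ℤ.*-identityʳ (+ m)) (ℤ.*-identityʳ (+ n))))

fromℕ-mono-≤ : ∀ {m n} → m ℕ.≤ n → fromℕ m ≤ fromℕ n
fromℕ-mono-≤ {m} {n} m≤n = frac-≤ m 0 n 0 (ℕ.*-monoˡ-≤ 1 m≤n)

frac-nonNeg : ∀ a b → 0ℚ ≤ frac a b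
frac-nonNeg a zero    = ℚ.≤-refl
frac-nonNeg a (suc b) = frac-≤ 0 0 a b z≤n

*-nonNeg : ∀ {x y} → 0ℚ ≤ x → 0ℚ ≤ y → 0ℚ ≤ x * y
*-nonNeg {x} {y} 0≤x 0≤y =
  ℚ.nonNegative⁻¹ (x * y) {{ℚ.nonNeg*nonNeg⇒nonNeg x {{ℚ.nonNegative 0≤x}} y {{ℚ.nonNegative 0≤y}}}}

*-monoˡ-≤-0≤ : ∀ {r x y} → 0ℚ ≤ r → x ≤ y → r * x ≤ r * y
*-monoˡ-≤-0≤ {r} 0≤r = ℚ.*-monoˡ-≤-nonNeg r {{ℚ.nonNegative 0≤r}}

*-monoʳ-≤-0≤ : ∀ {r x y} → 0ℚ ≤ r → x ≤ y → x * r ≤ y * r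
*-monoʳ-≤-0≤ {r} 0≤r = ℚ.*-monoʳ-≤-nonNeg r {{ℚ.nonNegative 0≤r}}

fromℕ≡frac*fromℕ : ∀ a t → fromℕ a ≡ frac a (suc t) * fromℕ (suc t)
fromℕ≡frac*fromℕ a t = sym (trans (frac-* a t (suc t) 0) (frac-≡ (a ℕ.* suc t) _ a 0 (ℕ.*-assoc a (suc t) 1)))

fromℕ*inv : ∀ b → 0 ℕ.< b → fromℕ b * inv b ≡ 1ℚ
fromℕ*inv (suc t) _ = trans (ℚ.*-comm (fromℕ (suc t)) (inv (suc t))) (sym (fromℕ≡frac*fromℕ 1 t))

digit*inv≡ratio*[1-inv] : ∀ d b → 1 ℕ.< b → fromℕ d * inv b ≡ frac d (b ∸ 1) * (1ℚ - inv b)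
digit*inv≡ratio*[1-inv] d b@(suc (suc t)) (s≤s (s≤s z≤n)) = begin
  fromℕ d * r                          ≡⟨ cong (_* r) (fromℕ≡frac*fromℕ d t) ⟩
  c * fromℕ (suc t) * r                ≡⟨ regroup c (fromℕ (suc t)) r ⟩
  c * ((1ℚ + fromℕ (suc t)) * r - r)   ≡⟨ cong (λ z → c * (z * r - r)) (fromℕ-+ 1 (suc t)) ⟨
  c * (fromℕ b * r - r)                ≡⟨ cong (λ z → c * (z - r)) (fromℕ*inv b (s≤s z≤n)) ⟩
  c * (1ℚ - r)                         ∎
  where
  open ≡-Reasoning
  c = frac d (suc t)
  r = inv b
  regroup : ∀ c D r → c * D * r ≡ c * ((1ℚ + D) * r - r)
  regroup = solve-∀ ℚ-ring

digit*inv≤1 : ∀ d b → d ℕ.< b → fromℕ d * inv b ≤ 1ℚ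
digit*inv≤1 d b d<b = begin
  fromℕ d * inv b  ≤⟨ *-monoʳ-≤-0≤ (frac-nonNeg 1 b) (fromℕ-mono-≤ (ℕ.<⇒≤ d<b)) ⟩
  fromℕ b * inv b  ≡⟨ fromℕ*inv b (ℕ.≤-trans (s≤s z≤n) d<b) ⟩
  1ℚ               ∎
  where open ℚ.≤-Reasoning

ratio≤1 : ∀ d b → d ℕ.< b → frac d (b ∸ 1) ≤ 1ℚ
ratio≤1 d (suc zero)    _          = frac-≤ 0 0 1 0 z≤n
ratio≤1 d (suc (suc t)) (s≤s d≤st) = frac-≤ d t 1 0 (subst₂ ℕ._≤_ (sym (ℕ.*-identityʳ d)) (sym (ℕ.*-identityˡ (suc t))) d≤st)

inv≤½ : ∀ b → 1 ℕ.< b → inv b ≤ ½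
inv≤½ (suc (suc t)) (s≤s (s≤s z≤n)) = frac-≤ 1 (suc t) 1 1 (s≤s (s≤s z≤n))

inv-suc*½≤inv-suc-suc : ∀ i → inv (suc i) * ½ ≤ inv (suc (suc i))
inv-suc*½≤inv-suc-suc i =
  subst (_≤ inv (suc (suc i))) (sym (frac-* 1 i 1 1)) (frac-≤ 1 _ 1 (suc i) (ℕ.*-monoʳ-≤ 1 2+i≤[1+i]*2))
  where
  2+i≤[1+i]*2 : suc (suc i) ℕ.≤ suc i ℕ.* 2
  2+i≤[1+i]*2 = subst (suc (suc i) ℕ.≤_)
    (sym (trans (ℕ.*-comm (suc i) 2) (cong (suc i ℕ.+_) (ℕ.+-identityʳ (suc i)))))
    (s≤s (ℕ.m≤n+m (suc i) i))

halves : ∀ x → ½ * x + ½ * x ≡ x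
halves x = trans (sym (ℚ.*-distribʳ-+ x ½ ½)) (ℚ.*-identityˡ x)

-- SameLimit a b unfolds to Vanishes (λ i → ∣ a i - b i ∣).
Vanishes : (ℕ → ℚ) → Set
Vanishes a = ∀ e → 0ℚ < e → ∃ λ M → ∀ i → M ℕ.≤ i → a i ≤ e

infix 4 _⟶_
_⟶_ : (ℕ → ℚ) → ℚ → Set
a ⟶ x = Vanishes (λ i → ∣ a i - x ∣)

vanishes-mono : ∀ {a b : ℕ → ℚ} → (∀ i → a i ≤ b i) → Vanishes b → Vanishes a
vanishes-mono a≤b vb e e>0 with vb e e>0
... | M , b≤e = M , λ i M≤i → ℚ.≤-trans (a≤b i) (b≤e i M≤i)

vanishes-+ : ∀ {a b : ℕ → ℚ} → Vanishes a → Vanishes b → Vanishes (λ i → a i + b i)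
vanishes-+ {a} {b} va vb e e>0 with va (½ * e) ½e>0 | vb (½ * e) ½e>0
  where
  instance _ = positive e>0
  ½e>0 : 0ℚ < ½ * e
  ½e>0 = ℚ.positive⁻¹ (½ * e) {{ℚ.pos*pos⇒pos ½ e}}
... | M , a≤½e | N , b≤½e = M ℕ.⊔ N , λ i M⊔N≤i → begin
  a i + b i      ≤⟨ ℚ.+-mono-≤ (a≤½e i (ℕ.m⊔n≤o⇒m≤o M N M⊔N≤i)) (b≤½e i (ℕ.m⊔n≤o⇒n≤o M N M⊔N≤i)) ⟩
  ½ * e + ½ * e  ≡⟨ halves e ⟩
  e              ∎
  where open ℚ.≤-Reasoning

-- Archimedean property: for e = (1+p)/(1+d), every i ≥ d has 1/(1+i) ≤ e.
inv-suc-vanishes : Vanishes (λ i → inv (suc i))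
inv-suc-vanishes e@(mkℚ ℤ.+[1+ p ] d _) _ = d , λ i d≤i →
  subst (inv (suc i) ≤_) (ℚ.↥p/↧p≡p e) (frac-≤ 1 i (suc p) d (cross-multiplied i d≤i))
  where
  cross-multiplied : ∀ i → d ℕ.≤ i → 1 ℕ.* suc d ℕ.≤ suc p ℕ.* suc i
  cross-multiplied i d≤i = ℕ.≤-trans (s≤s (ℕ.≤-trans (ℕ.≤-reflexive (ℕ.+-identityʳ d)) d≤i)) (ℕ.m≤n*m (suc i) (suc p))
inv-suc-vanishes (mkℚ (+ zero) _ _) (ℚ.*<* (ℤ.+<+ ()))
inv-suc-vanishes (mkℚ ℤ.-[1+ _ ] _ _) (ℚ.*<* ())

≤-vanishing⇒≤0 : ∀ {x} {a : ℕ → ℚ} → (∀ i → x ≤ a i) → Vanishes a → x ≤ 0ℚ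
≤-vanishing⇒≤0 {x} x≤a va with x ℚ.≤? 0ℚ
... | yes x≤0 = x≤0
... | no x≰0 with ℚ.<-dense (ℚ.≰⇒> x≰0)
...   | z , 0<z , z<x with va z 0<z
...     | M , a≤z = ⊥-elim (ℚ.<-irrefl refl (ℚ.≤-<-trans (ℚ.≤-trans (x≤a M) (a≤z M ℕ.≤-refl)) z<x))

dist-sym : ∀ x y → ∣ x - y ∣ ≡ ∣ y - x ∣
dist-sym x y = trans (sym (ℚ.∣-p∣≡∣p∣ (x - y))) (cong ∣_∣ (neg-diff x y))
  where
  neg-diff : ∀ x y → - (x - y) ≡ y - x
  neg-diff = solve-∀ ℚ-ring

dist-triangle : ∀ x y z → ∣ x - z ∣ ≤ ∣ x - y ∣ + ∣ y - z ∣
dist-triangle x y z = subst (λ w → ∣ w ∣ ≤ ∣ x - y ∣ + ∣ y - z ∣) (telescope x y z) (ℚ.∣p+q∣≤∣p∣+∣q∣ (x - y) (y - z))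
  where
  telescope : ∀ x y z → (x - y) + (y - z) ≡ x - z
  telescope = solve-∀ ℚ-ring

dist≤0⇒≡ : ∀ x y → ∣ x - y ∣ ≤ 0ℚ → x ≡ y
dist≤0⇒≡ x y d≤0 = x∙y⁻¹≈ε⇒x≈y x y (ℚ.∣p∣≡0⇒p≡0 (x - y) (ℚ.≤-antisym d≤0 (ℚ.0≤∣p∣ (x - y))))
  where open GroupProperties +-0-group using (x∙y⁻¹≈ε⇒x≈y)

⟶⇒sameLimit : ∀ {a b : ℕ → ℚ} {x} → a ⟶ x → b ⟶ x → SameLimit a b
⟶⇒sameLimit {a} {b} {x} a⟶x b⟶x = vanishes-mono bound (vanishes-+ a⟶x b⟶x)
  where
  bound : ∀ i → ∣ a i - b i ∣ ≤ ∣ a i - x ∣ + ∣ b i - x ∣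
  bound i = subst (λ w → ∣ a i - b i ∣ ≤ ∣ a i - x ∣ + w) (dist-sym x (b i)) (dist-triangle (a i) x (b i))

sameLimit⇒≡ : ∀ {a b : ℕ → ℚ} {x y} → a ⟶ x → b ⟶ y → SameLimit a b → x ≡ y
sameLimit⇒≡ {a} {b} {x} {y} a⟶x b⟶y a~b =
  dist≤0⇒≡ x y (≤-vanishing⇒≤0 bound (vanishes-+ (vanishes-+ a⟶x a~b) b⟶y))
  where
  bound : ∀ i → ∣ x - y ∣ ≤ ∣ a i - x ∣ + ∣ a i - b i ∣ + ∣ b i - y ∣
  bound i = begin
    ∣ x - y ∣                                    ≤⟨ dist-triangle x (a i) y ⟩
    ∣ x - a i ∣ + ∣ a i - y ∣                     ≤⟨ ℚ.+-monoʳ-≤ (∣ x - a i ∣) (dist-triangle (a i) (b i) y) ⟩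
    ∣ x - a i ∣ + (∣ a i - b i ∣ + ∣ b i - y ∣)   ≡⟨ cong (_+ _) (dist-sym x (a i)) ⟩
    ∣ a i - x ∣ + (∣ a i - b i ∣ + ∣ b i - y ∣)   ≡⟨ ℚ.+-assoc (∣ a i - x ∣) (∣ a i - b i ∣) (∣ b i - y ∣) ⟨
    ∣ a i - x ∣ + ∣ a i - b i ∣ + ∣ b i - y ∣     ∎
    where open ℚ.≤-Reasoning

module Expansion (q ε : ℕ → ℕ)
                 (q>1 : ∀ k → 1 ℕ.≤ k → 1 ℕ.< q k)
                 (ε<q : ∀ k → 1 ℕ.≤ k → ε k ℕ.< q k) where

  ratio : ℕ → ℚ
  ratio k = frac (ε k) (q k ∸ 1)

  1≤n+suc : ∀ n i → 1 ℕ.≤ n ℕ.+ suc i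
  1≤n+suc n i = ℕ.≤-trans (s≤s z≤n) (ℕ.m≤n+m (suc i) n)

  P-nonNeg : ∀ n i → 0ℚ ≤ P q n i
  P-nonNeg n zero    = frac-nonNeg 1 1
  P-nonNeg n (suc i) = *-nonNeg (P-nonNeg n i) (frac-nonNeg 1 (q (n ℕ.+ suc i)))

  P≤inv-suc : ∀ n i → P q n i ≤ inv (suc i)
  P≤inv-suc n zero    = ℚ.≤-refl
  P≤inv-suc n (suc i) = begin
    P q n i * r        ≤⟨ *-monoʳ-≤-0≤ (frac-nonNeg 1 (q k)) (P≤inv-suc n i) ⟩
    inv (suc i) * r    ≤⟨ *-monoˡ-≤-0≤ (frac-nonNeg 1 (suc i)) (inv≤½ (q k) (q>1 k (1≤n+suc n i))) ⟩
    inv (suc i) * ½    ≤⟨ inv-suc*½≤inv-suc-suc i ⟩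
    inv (suc (suc i))  ∎
    where
    open ℚ.≤-Reasoning
    k = n ℕ.+ suc i
    r = inv (q k)

  P-vanishes : ∀ n → Vanishes (P q n)
  P-vanishes n = vanishes-mono (P≤inv-suc n) inv-suc-vanishes

  P-shift : ∀ n i → P q n (suc i) ≡ inv (q (suc n)) * P q (suc n) i
  P-shift n zero rewrite ℕ.+-comm n 1 = ℚ.*-comm 1ℚ (inv (q (suc n)))
  P-shift n (suc i) = begin
    P q n (suc i) * inv (q (n ℕ.+ suc (suc i)))           ≡⟨ cong₂ (λ p k → p * inv (q k)) (P-shift n i) (ℕ.+-suc n (suc i)) ⟩
    inv (q (suc n)) * P q (suc n) i * inv (q (suc n ℕ.+ suc i)) ≡⟨ ℚ.*-assoc (inv (q (suc n))) (P q (suc n) i) (inv (q (suc n ℕ.+ suc i))) ⟩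
    inv (q (suc n)) * P q (suc n) (suc i)                  ∎
    where open ≡-Reasoning

  S-shift : ∀ n i → S q ε n (suc i) ≡ fromℕ (ε (suc n)) * inv (q (suc n)) + inv (q (suc n)) * S q ε (suc n) i
  S-shift n zero rewrite ℕ.+-comm n 1 = first-term (fromℕ (ε (suc n))) (inv (q (suc n)))
    where
    first-term : ∀ d r → 0ℚ + d * (1ℚ * r) ≡ d * r + r * 0ℚ
    first-term = solve-∀ ℚ-ring
  S-shift n (suc i) = begin
    S q ε n (suc i) + fromℕ (ε (n ℕ.+ suc (suc i))) * P q n (suc (suc i))
      ≡⟨ cong₂ (λ s p → s + fromℕ (ε (n ℕ.+ suc (suc i))) * p) (S-shift n i) (P-shift n (suc i)) ⟩
    d * r + r * S q ε (suc n) i + fromℕ (ε (n ℕ.+ suc (suc i))) * (r * P q (suc n) (suc i))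
      ≡⟨ cong (λ k → d * r + r * S q ε (suc n) i + fromℕ (ε k) * (r * P q (suc n) (suc i))) (ℕ.+-suc n (suc i)) ⟩
    d * r + r * S q ε (suc n) i + fromℕ (ε (suc n ℕ.+ suc i)) * (r * P q (suc n) (suc i))
      ≡⟨ factor-r d r (S q ε (suc n) i) (fromℕ (ε (suc n ℕ.+ suc i))) (P q (suc n) (suc i)) ⟩
    d * r + r * S q ε (suc n) (suc i) ∎
    where
    open ≡-Reasoning
    d = fromℕ (ε (suc n))
    r = inv (q (suc n))
    factor-r : ∀ d r s e p → d * r + r * s + e * (r * p) ≡ d * r + r * (s + e * p)
    factor-r = solve-∀ ℚ-ring

  S-suc : ∀ n i → let k = n ℕ.+ suc i in
          S q ε n (suc i) ≡ S q ε n i + P q n i * (fromℕ (ε k) * inv (q k))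
  S-suc n i = cong (λ t → S q ε n i + t) (reassoc (fromℕ (ε (n ℕ.+ suc i))) (P q n i) (inv (q (n ℕ.+ suc i))))
    where
    reassoc : ∀ d p r → d * (p * r) ≡ p * (d * r)
    reassoc = solve-∀ ℚ-ring

  S-increment≤P : ∀ n i → ∣ S q ε n i - S q ε n (suc i) ∣ ≤ P q n i
  S-increment≤P n i = begin
    ∣ S q ε n i - S q ε n (suc i) ∣  ≡⟨ dist-sym (S q ε n i) (S q ε n (suc i)) ⟩
    ∣ S q ε n (suc i) - S q ε n i ∣  ≡⟨ cong (λ s → ∣ s - S q ε n i ∣) (S-suc n i) ⟩
    ∣ S q ε n i + t - S q ε n i ∣   ≡⟨ cong ∣_∣ (add-sub (S q ε n i) t) ⟩
    ∣ t ∣                            ≡⟨ ℚ.0≤p⇒∣p∣≡p (*-nonNeg (P-nonNeg n i) (*-nonNeg (frac-nonNeg (ε k) 1) (frac-nonNeg 1 (q k)))) ⟩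
    P q n i * (fromℕ (ε k) * inv (q k)) ≤⟨ *-monoˡ-≤-0≤ (P-nonNeg n i) (digit*inv≤1 _ _ (ε<q k (1≤n+suc n i))) ⟩
    P q n i * 1ℚ                     ≡⟨ ℚ.*-identityʳ _ ⟩
    P q n i                          ∎
    where
    open ℚ.≤-Reasoning
    k = n ℕ.+ suc i
    t = P q n i * (fromℕ (ε k) * inv (q k))
    add-sub : ∀ s t → s + t - s ≡ t
    add-sub = solve-∀ ℚ-ring

  S+C*P≡C : ∀ n C → (∀ k → n ℕ.< k → ratio k ≡ C) → ∀ i → S q ε n i + C * P q n i ≡ C
  S+C*P≡C n C ratio≡C zero    = empty-sum C
    where
    empty-sum : ∀ C → 0ℚ + C * 1ℚ ≡ C
    empty-sum = solve-∀ ℚ-ring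
  S+C*P≡C n C ratio≡C (suc i) = begin
    S q ε n (suc i) + C * (p * r)          ≡⟨ cong (_+ C * (p * r)) (S-suc n i) ⟩
    S q ε n i + p * (d * r) + C * (p * r)  ≡⟨ cong (λ w → S q ε n i + p * w + C * (p * r)) digit-weight ⟩
    S q ε n i + p * (C * (1ℚ - r)) + C * (p * r)  ≡⟨ collect (S q ε n i) p C r ⟩
    S q ε n i + C * p                      ≡⟨ S+C*P≡C n C ratio≡C i ⟩
    C                                      ∎
    where
    open ≡-Reasoning
    k = n ℕ.+ suc i
    p = P q n i
    d = fromℕ (ε k)
    r = inv (q k)
    digit-weight : d * r ≡ C * (1ℚ - r)
    digit-weight = trans (digit*inv≡ratio*[1-inv] (ε k) (q k) (q>1 k (1≤n+suc n i)))
                         (cong (_* (1ℚ - r)) (ratio≡C k (ℕ.m<m+n n (s≤s z≤n))))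
    collect : ∀ s p C r → s + p * (C * (1ℚ - r)) + C * (p * r) ≡ s + C * p
    collect = solve-∀ ℚ-ring

  S⟶constant-ratio : ∀ n C → (∀ k → n ℕ.< k → ratio k ≡ C) → S q ε n ⟶ C
  S⟶constant-ratio n C ratio≡C = vanishes-mono distance≤P (P-vanishes n)
    where
    C-bounds : 0ℚ ≤ C × C ≤ 1ℚ
    C-bounds = subst (λ c → 0ℚ ≤ c × c ≤ 1ℚ) (ratio≡C (suc n) ℕ.≤-refl)
                     (frac-nonNeg (ε (suc n)) (q (suc n) ∸ 1) , ratio≤1 (ε (suc n)) (q (suc n)) (ε<q (suc n) (s≤s z≤n)))
    distance≤P : ∀ i → ∣ S q ε n i - C ∣ ≤ P q n i
    distance≤P i = begin
      ∣ S q ε n i - C ∣                    ≡⟨ cong (λ c → ∣ S q ε n i - c ∣) (S+C*P≡C n C ratio≡C i) ⟨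
      ∣ S q ε n i - (S q ε n i + C * p) ∣  ≡⟨ cong ∣_∣ (sub-add (S q ε n i) (C * p)) ⟩
      ∣ - (C * p) ∣                        ≡⟨ ℚ.∣-p∣≡∣p∣ (C * p) ⟩
      ∣ C * p ∣                            ≡⟨ ℚ.0≤p⇒∣p∣≡p (*-nonNeg (proj₁ C-bounds) (P-nonNeg n i)) ⟩
      C * p                                ≤⟨ *-monoʳ-≤-0≤ (P-nonNeg n i) (proj₂ C-bounds) ⟩
      1ℚ * p                               ≡⟨ ℚ.*-identityˡ p ⟩
      p                                    ∎
      where
      open ℚ.≤-Reasoning
      p = P q n i
      sub-add : ∀ s t → s - (s + t) ≡ - t
      sub-add = solve-∀ ℚ-ring

  S⟶ratio : ∀ j → SameLimit (S q ε (suc j)) (S q ε j) → S q ε (suc j) ⟶ ratio (suc j)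
  S⟶ratio j S[1+j]~S[j] = vanishes-mono distance≤2u (vanishes-+ u-vanishes u-vanishes)
    where
    k = suc j
    r = inv (q k)
    c = ratio k
    u : ℕ → ℚ
    u i = ∣ S q ε k i - S q ε j i ∣ + P q j i
    u-vanishes : Vanishes u
    u-vanishes = vanishes-+ S[1+j]~S[j] (P-vanishes j)
    digit-weight : fromℕ (ε k) * r ≡ c * (1ℚ - r)
    digit-weight = digit*inv≡ratio*[1-inv] (ε k) (q k) (q>1 k (s≤s z≤n))
    ½≤1-r : ½ ≤ 1ℚ - r
    ½≤1-r = ℚ.+-monoʳ-≤ 1ℚ (ℚ.neg-antimono-≤ (inv≤½ (q k) (q>1 k (s≤s z≤n))))
    contraction : ∀ i → S q ε k i - S q ε j (suc i) ≡ (1ℚ - r) * (S q ε k i - c)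
    contraction i = begin
      S q ε k i - S q ε j (suc i)                     ≡⟨ cong (λ w → S q ε k i - w) (S-shift j i) ⟩
      S q ε k i - (fromℕ (ε k) * r + r * S q ε k i)    ≡⟨ cong (λ w → S q ε k i - (w + r * S q ε k i)) digit-weight ⟩
      S q ε k i - (c * (1ℚ - r) + r * S q ε k i)       ≡⟨ factor (S q ε k i) c r ⟩
      (1ℚ - r) * (S q ε k i - c)                       ∎
      where
      open ≡-Reasoning
      factor : ∀ s c r → s - (c * (1ℚ - r) + r * s) ≡ (1ℚ - r) * (s - c)
      factor = solve-∀ ℚ-ring
    half-distance≤u : ∀ i → ½ * ∣ S q ε k i - c ∣ ≤ u i
    half-distance≤u i = begin
      ½ * ∣ x ∣                                  ≤⟨ *-monoʳ-≤-0≤ (ℚ.0≤∣p∣ x) ½≤1-r ⟩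
      (1ℚ - r) * ∣ x ∣                           ≡⟨ cong (_* ∣ x ∣) (ℚ.0≤p⇒∣p∣≡p (ℚ.≤-trans (ℚ.nonNegative⁻¹ ½) ½≤1-r)) ⟨
      ∣ 1ℚ - r ∣ * ∣ x ∣                         ≡⟨ ℚ.∣p*q∣≡∣p∣*∣q∣ (1ℚ - r) x ⟨
      ∣ (1ℚ - r) * x ∣                           ≡⟨ cong ∣_∣ (contraction i) ⟨
      ∣ S q ε k i - S q ε j (suc i) ∣            ≤⟨ dist-triangle (S q ε k i) (S q ε j i) (S q ε j (suc i)) ⟩
      ∣ S q ε k i - S q ε j i ∣ + ∣ S q ε j i - S q ε j (suc i) ∣ ≤⟨ ℚ.+-monoʳ-≤ (∣ S q ε k i - S q ε j i ∣) (S-increment≤P j i) ⟩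
      u i                                        ∎
      where
      open ℚ.≤-Reasoning
      x = S q ε k i - c
    distance≤2u : ∀ i → ∣ S q ε k i - c ∣ ≤ u i + u i
    distance≤2u i = subst (_≤ u i + u i) (halves ∣ S q ε k i - c ∣)
                          (ℚ.+-mono-≤ (half-distance≤u i) (half-distance≤u i))

lemma3 : (q ε : ℕ → ℕ) (n₀ : ℕ)
    → (∀ k → 1 ℕ.≤ k → 1 ℕ.< q k)
    → (∀ k → 1 ℕ.≤ k → ε k ℕ.< q k)
    → 1 ℕ.≤ n₀
    → (∀ n m → n₀ ℕ.≤ n → n₀ ℕ.≤ m → SameLimit (S q ε n) (S q ε m))
      ⇔ (∀ n m → n₀ ℕ.< n → n₀ ℕ.< m → frac (ε n) (q n ∸ 1) ≡ frac (ε m) (q m ∸ 1))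
lemma3 q ε n₀ q>1 ε<q _ = mk⇔ constant-limit⇒constant-ratio constant-ratio⇒constant-limit
  where
  open Expansion q ε q>1 ε<q

  constant-limit⇒constant-ratio : (∀ n m → n₀ ℕ.≤ n → n₀ ℕ.≤ m → SameLimit (S q ε n) (S q ε m))
                                → ∀ n m → n₀ ℕ.< n → n₀ ℕ.< m → ratio n ≡ ratio m
  constant-limit⇒constant-ratio same n m n₀<n n₀<m =
    sameLimit⇒≡ {S q ε n} {S q ε m} (S[k]⟶ratio[k] n n₀<n) (S[k]⟶ratio[k] m n₀<m)
                (same n m (ℕ.<⇒≤ n₀<n) (ℕ.<⇒≤ n₀<m))
    where
    S[k]⟶ratio[k] : ∀ k → n₀ ℕ.< k → S q ε k ⟶ ratio k
    S[k]⟶ratio[k] (suc j) (s≤s n₀≤j) = S⟶ratio j (same (suc j) j (ℕ.m≤n⇒m≤1+n n₀≤j) n₀≤j)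

  constant-ratio⇒constant-limit : (∀ n m → n₀ ℕ.< n → n₀ ℕ.< m → ratio n ≡ ratio m)
                                → ∀ n m → n₀ ℕ.≤ n → n₀ ℕ.≤ m → SameLimit (S q ε n) (S q ε m)
  constant-ratio⇒constant-limit same n m n₀≤n n₀≤m = ⟶⇒sameLimit {S q ε n} {S q ε m} (S⟶C n₀≤n) (S⟶C n₀≤m)
    where
    S⟶C : ∀ {n} → n₀ ℕ.≤ n → S q ε n ⟶ ratio (suc n₀)
    S⟶C {n} n₀≤n = S⟶constant-ratio n (ratio (suc n₀))
                     (λ k n<k → same k (suc n₀) (ℕ.≤-<-trans n₀≤n n<k) ℕ.≤-refl)
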